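{- Let $\mathcal Z=(z_n)_{n=1}^\infty$ be an eventually Zsigmondy sequence of integers, let $r\ge1$, and let $\Gamma=\{g_1^{k_1}\cdots g_r^{k_r}:\ k_1,\ldots,k_r\in\mathbb{Z}\}$ for nonzero integers $g_1,\ldots,g_r$, where $r$ is the smallest number of elements generating $\Gamma$ in this way. Let $\overline\Gamma=\{z\in\mathbb{Z}:\ z^m\in\Gamma \text{ for some } m\in\mathbb{N}\}$. Then there is a constant $C(\mathcal Z,r)$, depending only on $\mathcal Z$ and $r$, such that \[ \#\{n\in\mathbb{N}:\ z_n\in\overline\Gamma\}\le C(\mathcal Z,r). \]
   Context: A sequence of integers $(z_n)_{n\ge1}$ is eventually Zsigmondy if there is $N_0\ge1$ such that every term $z_n$ with $n\ge N_0$ has a primitive prime divisor, i.e. a prime dividing $z_n$ but not dividing $z_m$ for any $1\le m<n$. -}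

module Defs where

open import Data.Nat as ℕ using (ℕ; zero; suc; _<_; _≤_)
open import Data.Nat.Divisibility using (_∣_)
open import Data.Nat.Primality using (Prime)
open import Data.Integer as ℤ using (ℤ; +_; -[1+_]; ∣_∣)
open import Data.Rational as ℚ using (ℚ; mkℚ; 0ℚ; 1ℚ; _*_; _/_)
open import Data.Fin using (Fin; zero; suc)
open import Data.Product using (Σ; _×_)
open import Relation.Nullary using (¬_)
open import Relation.Binary.PropositionalEquality using (_≡_; _≢_; sym)
open import Function.Bundles using (_⇔_)

-- Sequences z = (z_n)_{n ≥ 1} are functions ℕ → ℤ; the value at 0 is ignored.

PrimitivePrimeDivisor : (ℕ → ℤ) → ℕ → ℕ → Set
PrimitivePrimeDivisor z n p =
  Prime p × (p ∣ ∣ z n ∣) × (∀ m → 1 ≤ m → m < n → ¬ (p ∣ ∣ z m ∣))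

EventuallyZsigmondy : (ℕ → ℤ) → Set
EventuallyZsigmondy z =
  Σ ℕ λ N₀ → 1 ≤ N₀ × (∀ n → N₀ ≤ n → Σ ℕ λ p → PrimitivePrimeDivisor z n p)

toℚ : ℤ → ℚ
toℚ a = a / 1

_^ℕ_ : ℚ → ℕ → ℚ
q ^ℕ zero = 1ℚ
q ^ℕ suc n = q * (q ^ℕ n)

-- multiplicative inverse in ℚ, made total by setting inv 0 = 0
-- (only ever applied to nonzero rationals in the statement)
inv : ℚ → ℚ
inv (mkℚ (+ zero) d prf) = 0ℚ
inv (mkℚ ℤ.+[1+ n ] d prf) = mkℚ ℤ.+[1+ d ] n (ℕ.sym prf)
  where import Data.Nat.Coprimality as ℕ
inv (mkℚ -[1+ n ] d prf) = mkℚ -[1+ d ] n (ℕ.sym prf)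
  where import Data.Nat.Coprimality as ℕ

_^ℤ_ : ℚ → ℤ → ℚ
q ^ℤ (+ n) = q ^ℕ n
q ^ℤ -[1+ n ] = inv (q ^ℕ suc n)

∏ : ∀ {r} → (Fin r → ℚ) → ℚ
∏ {zero} f = 1ℚ
∏ {suc r} f = f zero * ∏ (λ i → f (suc i))

InΓ : ∀ {r} → (Fin r → ℤ) → ℚ → Set
InΓ {r} g q = Σ (Fin r → ℤ) λ k → q ≡ ∏ (λ i → toℚ (g i) ^ℤ k i)

InΓbar : ∀ {r} → (Fin r → ℤ) → ℤ → Set
InΓbar g z = Σ ℕ λ m → 1 ≤ m × InΓ g (toℚ z ^ℕ m)

SameΓ : ∀ {r s} → (Fin r → ℤ) → (Fin s → ℤ) → Set
SameΓ g h = ∀ q → InΓ g q ⇔ InΓ h q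

MinimalGenerators : ∀ {r} → (Fin r → ℤ) → Set
MinimalGenerators {r} g =
  ∀ s → s < r → (h : Fin s → ℤ) → (∀ i → h i ≢ + 0) → ¬ SameΓ g h

module Submission where

-- Write z_n^{m_n} = ∏ g_i^{k_{n,i}} for each index n ≥ N₀ with z_n ∈ Γ̄. If there were more
-- than r such indices, their exponent vectors k_n ∈ ℤ^r would satisfy a nontrivial integer
-- relation ∑ c_n k_n = 0. Let t be the largest index with c_t ≠ 0 and p a primitive prime
-- divisor of z_t. Taking p-adic valuations gives m_n v_p(z_n) = ∑_i k_{n,i} v_p(g_i), hence
-- ∑ c_n m_n v_p(z_n) = 0; but v_p(z_n) = 0 for every n < t, so this sum is c_t m_t v_p(z_t) ≠ 0.
-- Thus C = N₀ + r works.

open import Defs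
open import Data.Nat using (ℕ; _≤_)
open import Data.Integer using (ℤ; +_)
open import Data.Fin using (Fin)
open import Data.List using (List; length)
open import Data.List.Relation.Unary.All using (All)
open import Data.List.Relation.Unary.Unique.Propositional using (Unique)
open import Data.Product using (Σ; _×_)
open import Relation.Binary.PropositionalEquality using (_≢_)

open import Data.Empty using (⊥)
open import Data.Fin as Fin using (zero; suc; punchIn)
import Data.Fin.Properties as Fin
open import Data.Integer as ℤ using (-[1+_]; 0ℤ; 1ℤ; -_; _-_; _≟_; ∣_∣)
  renaming (_+_ to _+ℤ_; _*_ to _*ℤ_)
import Data.Integer.Properties as ℤ
open import Data.Integer.Tactic.RingSolver using (solve-∀)
open import Data.List using ([]; _∷_; lookup; filter)
open import Data.List.Membership.Propositional.Properties using (∈-lookup)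
import Data.List.Relation.Unary.All as All
import Data.List.Relation.Unary.All.Properties as All
open import Data.List.Relation.Unary.AllPairs using (_∷_)
import Data.List.Relation.Unary.Unique.Propositional.Properties as Unique
open import Data.Nat as ℕ using (zero; suc; _<_; _<?_; _*_; _^_; s≤s; NonZero; nonTrivial⇒n>1)
import Data.Nat.Coprimality as Coprime
open import Data.Nat.Divisibility using (_∣_; divides; _∣?_; ∣1⇒≡1)
open import Data.Nat.Induction using (<-rec)
open import Data.Nat.Primality using (Prime; prime⇒nonZero; prime⇒nonTrivial; euclidsLemma)
import Data.Nat.Properties as ℕ
open import Data.Product using (∃; _,_; proj₁; proj₂)
open import Data.Rational as ℚ using (mkℚ; 0ℚ; 1ℚ; ↥_)
import Data.Rational.Properties as ℚ
open import Data.Sum using (inj₁; inj₂)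
open import Data.Vec.Functional using (insertAt)
open import Data.Vec.Functional.Properties using (insertAt-lookup; insertAt-punchIn)
open import Function using (_∘_)
open import Function.Definitions using (Injective)
open import Relation.Binary.PropositionalEquality
  using (_≡_; refl; sym; trans; cong; cong₂; subst; module ≡-Reasoning)
open import Relation.Nullary using (¬_; ¬?; yes; no; contradiction)
open import Relation.Unary using (Pred; Decidable)
open import Relation.Unary.Properties using (∁?)
open import Algebra.Bundles using (CommutativeMonoid; AbelianGroup)
open import Algebra.Definitions.RawMonoid ℕ.+-0-rawMonoid using () renaming (sum to ∑ℕ)
open import Algebra.Definitions.RawMonoid ℤ.*-1-rawMonoid using () renaming (sum to ∏ℤ)
open import Algebra.Properties.CommutativeSemigroup ℕ.*-commutativeSemigroup
  using () renaming (interchange to *-interchange)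
open import Algebra.Properties.CommutativeSemigroup
  (CommutativeMonoid.commutativeSemigroup ℚ.*-1-commutativeMonoid)
  using () renaming (interchange to ℚ-*-interchange)
open import Algebra.Properties.Group (AbelianGroup.group ℤ.+-0-abelianGroup)
  using () renaming (∙-cancelʳ to +-cancelʳ)
open import Algebra.Properties.Semiring.Sum ℤ.+-*-semiring
  using (sum-syntax; sum-remove; sum-cong-≗; sum-replicate-zero; ∑-distrib-+; ∑-comm;
         *-distribˡ-sum; *-distribʳ-sum)

∑-cong : ∀ {n} {f g : Fin n → ℤ} → (∀ j → f j ≡ g j) → ∑[ j < n ] f j ≡ ∑[ j < n ] g j
∑-cong = sum-cong-≗

∑-zero : ∀ {n} {f : Fin n → ℤ} → (∀ j → f j ≡ 0ℤ) → ∑[ j < n ] f j ≡ 0ℤ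
∑-zero {n} f≡0 = trans (∑-cong f≡0) (sum-replicate-zero n)

∑-*+* : ∀ {n} a b (f g : Fin n → ℤ) →
  ∑[ j < n ] (a *ℤ f j +ℤ b *ℤ g j) ≡ a *ℤ ∑[ j < n ] f j +ℤ b *ℤ ∑[ j < n ] g j
∑-*+* a b f g = trans (∑-distrib-+ (λ j → a *ℤ f j) (λ j → b *ℤ g j))
  (sym (cong₂ _+ℤ_ (*-distribˡ-sum a f) (*-distribˡ-sum b g)))

∑-concentrated : ∀ {n} {f : Fin n → ℤ} (t : Fin n) →
  (∀ j → j ≢ t → f j ≡ 0ℤ) → ∑[ j < n ] f j ≡ f t
∑-concentrated {suc n} {f} t vanish = begin
  ∑[ j < suc n ] f j                  ≡⟨ sum-remove {i = t} f ⟩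
  f t +ℤ ∑[ j < n ] f (punchIn t j)   ≡⟨ cong (f t +ℤ_) (∑-zero (λ j → vanish _ (Fin.punchInᵢ≢i t j))) ⟩
  f t +ℤ 0ℤ                           ≡⟨ ℤ.+-identityʳ (f t) ⟩
  f t                                 ∎
  where open ≡-Reasoning

IsRelation : ∀ {n d} → (Fin n → Fin d → ℤ) → (Fin n → ℤ) → Set
IsRelation {n} v c = ∀ i → ∑[ j < n ] (c j *ℤ v j i) ≡ 0ℤ

IsNontrivialRelation : ∀ {n d} → (Fin n → Fin d → ℤ) → (Fin n → ℤ) → Set
IsNontrivialRelation v c = (∃ λ j → c j ≢ 0ℤ) × IsRelation v c

isRelation⇒∑-weighted≡0 : ∀ {n d} {v : Fin n → Fin d → ℤ} {c : Fin n → ℤ} → IsRelation v c →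
  (w : Fin d → ℤ) → ∑[ j < n ] (c j *ℤ ∑[ i < d ] (v j i *ℤ w i)) ≡ 0ℤ
isRelation⇒∑-weighted≡0 {n} {d} {v} {c} rel w = begin
  ∑[ j < n ] (c j *ℤ ∑[ i < d ] (v j i *ℤ w i))
    ≡⟨ ∑-cong (λ j → *-distribˡ-sum (c j) (λ i → v j i *ℤ w i)) ⟩
  ∑[ j < n ] ∑[ i < d ] (c j *ℤ (v j i *ℤ w i))
    ≡⟨ ∑-comm (λ j i → c j *ℤ (v j i *ℤ w i)) ⟩
  ∑[ i < d ] ∑[ j < n ] (c j *ℤ (v j i *ℤ w i))
    ≡⟨ ∑-cong (λ i → ∑-cong (λ j → sym (ℤ.*-assoc (c j) (v j i) (w i)))) ⟩
  ∑[ i < d ] ∑[ j < n ] (c j *ℤ v j i *ℤ w i)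
    ≡⟨ ∑-cong (λ i → *-distribʳ-sum (w i) (λ j → c j *ℤ v j i)) ⟨
  ∑[ i < d ] (∑[ j < n ] (c j *ℤ v j i) *ℤ w i)
    ≡⟨ ∑-zero (λ i → trans (cong (_*ℤ w i) (rel i)) (ℤ.*-zeroˡ (w i))) ⟩
  0ℤ
    ∎
  where open ≡-Reasoning

module Elimination {n d} (v : Fin (suc n) → Fin (suc d) → ℤ)
                   (j₀ : Fin (suc n)) (pivot≢0 : v j₀ zero ≢ 0ℤ) where

  private
    a : ℤ
    a = v j₀ zero

    u : Fin n → Fin (suc d) → ℤ
    u j = v (punchIn j₀ j)

  eliminated : Fin n → Fin d → ℤ
  eliminated j i = a *ℤ u j (suc i) - u j zero *ℤ v j₀ (suc i)

  module _ (c : Fin n → ℤ) where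

    private
      β : ℤ
      β = - ∑[ j < n ] (c j *ℤ u j zero)

    -- β cancels coordinate 0; on the other coordinates the lifted combination is c applied to
    -- the eliminated vectors.
    lifted : Fin (suc n) → ℤ
    lifted = insertAt (λ j → a *ℤ c j) j₀ β

    ∑-lifted : ∀ i → ∑[ j < suc n ] (lifted j *ℤ v j i) ≡ β *ℤ v j₀ i +ℤ a *ℤ ∑[ j < n ] (c j *ℤ u j i)
    ∑-lifted i = begin
      ∑[ j < suc n ] (lifted j *ℤ v j i)
        ≡⟨ sum-remove {i = j₀} (λ j → lifted j *ℤ v j i) ⟩
      lifted j₀ *ℤ v j₀ i +ℤ ∑[ j < n ] (lifted (punchIn j₀ j) *ℤ u j i)
        ≡⟨ cong₂ _+ℤ_ (cong (_*ℤ v j₀ i) (insertAt-lookup _ j₀ β)) (∑-cong λ j →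
             trans (cong (_*ℤ u j i) (insertAt-punchIn _ j₀ β j)) (ℤ.*-assoc a (c j) (u j i))) ⟩
      β *ℤ v j₀ i +ℤ ∑[ j < n ] (a *ℤ (c j *ℤ u j i))
        ≡⟨ cong (β *ℤ v j₀ i +ℤ_) (*-distribˡ-sum a (λ j → c j *ℤ u j i)) ⟨
      β *ℤ v j₀ i +ℤ a *ℤ ∑[ j < n ] (c j *ℤ u j i)
        ∎
      where open ≡-Reasoning

    lifted-isRelation : IsRelation eliminated c → IsRelation v lifted
    lifted-isRelation rel zero = trans (∑-lifted zero) (cancel a (∑[ j < n ] (c j *ℤ u j zero)))
      where
      cancel : ∀ a s → - s *ℤ a +ℤ a *ℤ s ≡ 0ℤ
      cancel = solve-∀
    lifted-isRelation rel (suc i) = begin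
      ∑[ j < suc n ] (lifted j *ℤ v j (suc i))                           ≡⟨ ∑-lifted (suc i) ⟩
      β *ℤ b +ℤ a *ℤ ∑[ j < n ] x j                                      ≡⟨ rearrange a _ _ b ⟩
      a *ℤ ∑[ j < n ] x j +ℤ - b *ℤ ∑[ j < n ] y j                       ≡⟨ ∑-*+* a (- b) x y ⟨
      ∑[ j < n ] (a *ℤ x j +ℤ - b *ℤ y j)
        ≡⟨ ∑-cong (λ j → regroup a b (c j) _ _) ⟩
      ∑[ j < n ] (c j *ℤ eliminated j i)                                 ≡⟨ rel i ⟩
      0ℤ                                                                 ∎
      where
      open ≡-Reasoning
      b = v j₀ (suc i)
      x y : Fin n → ℤ
      x j = c j *ℤ u j (suc i)
      y j = c j *ℤ u j zero
      rearrange : ∀ a s s₀ b → - s₀ *ℤ b +ℤ a *ℤ s ≡ a *ℤ s +ℤ - b *ℤ s₀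
      rearrange = solve-∀
      regroup : ∀ a b c x y → a *ℤ (c *ℤ x) +ℤ - b *ℤ (c *ℤ y) ≡ c *ℤ (a *ℤ x - y *ℤ b)
      regroup = solve-∀

    lifted-nontrivial : ∀ {j} → c j ≢ 0ℤ → lifted (punchIn j₀ j) ≢ 0ℤ
    lifted-nontrivial {j} cj≢0 eq with ℤ.i*j≡0⇒i≡0∨j≡0 a (trans (sym (insertAt-punchIn _ j₀ β j)) eq)
    ... | inj₁ a≡0 = pivot≢0 a≡0
    ... | inj₂ cj≡0 = cj≢0 cj≡0

  lift : ∀ {c} → IsNontrivialRelation eliminated c → ∃ (IsNontrivialRelation v)
  lift {c} ((j , cj≢0) , rel) = lifted c , (punchIn j₀ j , lifted-nontrivial c cj≢0) , lifted-isRelation c rel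

d<n⇒nontrivialRelation : ∀ {n d} → d < n → (v : Fin n → Fin d → ℤ) → ∃ (IsNontrivialRelation v)
d<n⇒nontrivialRelation {suc n} {zero} _ v = (λ _ → 1ℤ) , (zero , λ ()) , λ ()
d<n⇒nontrivialRelation {suc n} {suc d} (s≤s d<n) v with Fin.all? (λ j → v j zero ≟ 0ℤ)
... | yes column≡0 =
  let c , nontrivial , rel = d<n⇒nontrivialRelation (ℕ.m<n⇒m<1+n d<n) (λ j i → v j (suc i))
  in c , nontrivial , λ where
       zero → ∑-zero (λ j → trans (cong (c j *ℤ_) (column≡0 j)) (ℤ.*-zeroʳ (c j)))
       (suc i) → rel i
... | no ¬column≡0 =
  let j₀ , pivot≢0 = Fin.¬∀⟶∃¬ _ _ (λ j → v j zero ≟ 0ℤ) ¬column≡0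
      open Elimination v j₀ pivot≢0
  in lift (proj₂ (d<n⇒nontrivialRelation d<n eliminated))

argmax : ∀ {n p} {P : Pred (Fin n) p} → Decidable P → (f : Fin n → ℕ) → ∃ P →
  ∃ λ t → P t × (∀ j → P j → f j ℕ.≤ f t)
argmax {suc n} {P = P} P? f ∃P with Fin.any? (P? ∘ suc)
... | no ¬∃P∘suc = zero , atZero ∃P , λ where
        zero _ → ℕ.≤-refl
        (suc j) Pj → contradiction (j , Pj) ¬∃P∘suc
  where
  atZero : ∃ P → P zero
  atZero (zero , P0) = P0
  atZero (suc j , Pj) = contradiction (j , Pj) ¬∃P∘suc
... | yes ∃P∘suc with argmax (P? ∘ suc) (f ∘ suc) ∃P∘suc | P? zero
...   | t , Pt , max | no ¬P0 = suc t , Pt , λ where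
          zero P0 → contradiction P0 ¬P0
          (suc j) Pj → max j Pj
...   | t , Pt , max | yes P0 with f zero ℕ.≤? f (suc t)
...     | yes f0≤ft = suc t , Pt , λ where
            zero _ → f0≤ft
            (suc j) Pj → max j Pj
...     | no f0≰ft = zero , P0 , λ where
            zero _ → ℕ.≤-refl
            (suc j) Pj → ℕ.≤-trans (max j Pj) (ℕ.<⇒≤ (ℕ.≰⇒> f0≰ft))

record Valuation (p a e : ℕ) : Set where
  constructor valuation
  field
    cofactor : ℕ
    a≡pᵉ*cofactor : a ≡ p ^ e * cofactor
    p∤cofactor : ¬ p ∣ cofactor

module _ {p : ℕ} (p-prime : Prime p) where

  private instance
    p≢0 : NonZero p
    p≢0 = prime⇒nonZero p-prime

  private
    1<p : 1 < p
    1<p = nonTrivial⇒n>1 p {{prime⇒nonTrivial p-prime}}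

    p∤1 : ¬ p ∣ 1
    p∤1 p∣1 = ℕ.<⇒≢ 1<p (sym (∣1⇒≡1 p∣1))

    ^suc-* : ∀ e u → p ^ suc e * u ≡ p ^ e * u * p
    ^suc-* e u = trans (ℕ.*-assoc p (p ^ e) u) (ℕ.*-comm p (p ^ e * u))

  valuation-exists : ∀ {a} → a ≢ 0 → ∃ (Valuation p a)
  valuation-exists {a} = <-rec (λ a → a ≢ 0 → ∃ (Valuation p a)) step a
    where
    step : ∀ a → (∀ {b} → b < a → b ≢ 0 → ∃ (Valuation p b)) → a ≢ 0 → ∃ (Valuation p a)
    step a rec a≢0 with p ∣? a
    ... | no p∤a = 0 , valuation a (sym (ℕ.*-identityˡ a)) p∤a
    ... | yes (divides zero a≡0) = contradiction a≡0 a≢0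
    ... | yes (divides c@(suc _) a≡c*p)
          with rec (subst (c <_) (sym a≡c*p) (ℕ.m<m*n c p 1<p)) (λ ())
    ...   | e , valuation u c≡pᵉu p∤u =
      suc e , valuation u (trans a≡c*p (trans (cong (_* p) c≡pᵉu) (sym (^suc-* e u)))) p∤u

  valuation-unique : ∀ {a e f} → Valuation p a e → Valuation p a f → e ≡ f
  valuation-unique {e = e} {f} (valuation u a≡pᵉu p∤u) (valuation w a≡pᶠw p∤w) =
    go e f (trans (sym a≡pᵉu) a≡pᶠw)
    where
    go : ∀ e f → p ^ e * u ≡ p ^ f * w → e ≡ f
    go zero zero _ = refl
    go zero (suc f) eq =
      contradiction (divides (p ^ f * w) (trans (sym (ℕ.*-identityˡ u)) (trans eq (^suc-* f w)))) p∤u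
    go (suc e) zero eq =
      contradiction (divides (p ^ e * u) (trans (sym (ℕ.*-identityˡ w)) (trans (sym eq) (^suc-* e u)))) p∤w
    go (suc e) (suc f) eq = cong suc (go e f (ℕ.*-cancelˡ-≡ (p ^ e * u) (p ^ f * w) p
      (trans (sym (ℕ.*-assoc p (p ^ e) u)) (trans eq (ℕ.*-assoc p (p ^ f) w)))))

  valuation-* : ∀ {a b e f} → Valuation p a e → Valuation p b f → Valuation p (a * b) (e ℕ.+ f)
  valuation-* {a} {b} {e} {f} (valuation u a≡pᵉu p∤u) (valuation w b≡pᶠw p∤w) =
    valuation (u * w) a*b≡pᵉ⁺ᶠuw p∤uw
    where
    a*b≡pᵉ⁺ᶠuw : a * b ≡ p ^ (e ℕ.+ f) * (u * w)
    a*b≡pᵉ⁺ᶠuw = begin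
      a * b                     ≡⟨ cong₂ _*_ a≡pᵉu b≡pᶠw ⟩
      p ^ e * u * (p ^ f * w)   ≡⟨ *-interchange (p ^ e) u (p ^ f) w ⟩
      p ^ e * p ^ f * (u * w)   ≡⟨ cong (_* (u * w)) (ℕ.^-distribˡ-+-* p e f) ⟨
      p ^ (e ℕ.+ f) * (u * w)   ∎
      where open ≡-Reasoning
    p∤uw : ¬ p ∣ u * w
    p∤uw p∣uw with euclidsLemma u w p-prime p∣uw
    ... | inj₁ p∣u = p∤u p∣u
    ... | inj₂ p∣w = p∤w p∣w

  valuation-non-multiple : ∀ {a} → ¬ p ∣ a → Valuation p a 0
  valuation-non-multiple {a} p∤a = valuation a (sym (ℕ.*-identityˡ a)) p∤a

  valuation-multiple : ∀ {a e} → p ∣ a → Valuation p a e → e ≢ 0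
  valuation-multiple p∣a (valuation u a≡u p∤u) refl = p∤u (subst (p ∣_) (trans a≡u (ℕ.*-identityˡ u)) p∣a)

  valuation-∣*∣ : ∀ {a b e f} → Valuation p ∣ a ∣ e → Valuation p ∣ b ∣ f →
    Valuation p ∣ a *ℤ b ∣ (e ℕ.+ f)
  valuation-∣*∣ {a} {b} vₐ v_b = subst (λ x → Valuation p x _) (sym (ℤ.abs-* a b)) (valuation-* vₐ v_b)

  valuation-∣^∣ : ∀ {a e} → Valuation p ∣ a ∣ e → ∀ m → Valuation p ∣ a ℤ.^ m ∣ (m * e)
  valuation-∣^∣ vₐ zero = valuation-non-multiple p∤1
  valuation-∣^∣ {a} vₐ (suc m) = valuation-∣*∣ {a} {a ℤ.^ m} vₐ (valuation-∣^∣ vₐ m)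

  valuation-∣∏∣ : ∀ {r} {f : Fin r → ℤ} {e : Fin r → ℕ} → (∀ i → Valuation p ∣ f i ∣ (e i)) →
    Valuation p ∣ ∏ℤ f ∣ (∑ℕ e)
  valuation-∣∏∣ {zero} _ = valuation-non-multiple p∤1
  valuation-∣∏∣ {suc r} {f} v =
    valuation-∣*∣ {f zero} {∏ℤ (f ∘ suc)} (v zero) (valuation-∣∏∣ (v ∘ suc))

_⁺ _⁻ : ℤ → ℕ
(+ n) ⁺ = n
-[1+ n ] ⁺ = 0
(+ n) ⁻ = 0
-[1+ n ] ⁻ = suc n

^-≢0 : ∀ {a} → a ≢ 0ℤ → ∀ n → a ℤ.^ n ≢ 0ℤ
^-≢0 a≢0 (suc n) aⁿ⁺¹≡0 with ℤ.i*j≡0⇒i≡0∨j≡0 _ aⁿ⁺¹≡0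
... | inj₁ a≡0 = a≢0 a≡0
... | inj₂ aⁿ≡0 = ^-≢0 a≢0 n aⁿ≡0

∏ℤ-≢0 : ∀ {r} {f : Fin r → ℤ} → (∀ i → f i ≢ 0ℤ) → ∏ℤ f ≢ 0ℤ
∏ℤ-≢0 {zero} _ ()
∏ℤ-≢0 {suc r} {f} f≢0 ∏≡0 with ℤ.i*j≡0⇒i≡0∨j≡0 (f zero) ∏≡0
... | inj₁ f₀≡0 = f≢0 zero f₀≡0
... | inj₂ ∏′≡0 = ∏ℤ-≢0 (f≢0 ∘ suc) ∏′≡0

toℚ≡mkℚ : ∀ a → toℚ a ≡ mkℚ a 0 (Coprime.sym (Coprime.1-coprimeTo _))
toℚ≡mkℚ a = ℚ.↥p/↧p≡p (mkℚ a 0 (Coprime.sym (Coprime.1-coprimeTo _)))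

toℚ-injective : ∀ {a b} → toℚ a ≡ toℚ b → a ≡ b
toℚ-injective {a} {b} eq = cong ↥_ (trans (sym (toℚ≡mkℚ a)) (trans eq (toℚ≡mkℚ b)))

toℚ-* : ∀ a b → toℚ (a *ℤ b) ≡ toℚ a ℚ.* toℚ b
toℚ-* a b rewrite toℚ≡mkℚ a | toℚ≡mkℚ b = refl

toℚ-^ : ∀ a n → toℚ (a ℤ.^ n) ≡ toℚ a ^ℕ n
toℚ-^ a zero = refl
toℚ-^ a (suc n) = trans (toℚ-* a (a ℤ.^ n)) (cong (toℚ a ℚ.*_) (toℚ-^ a n))

inv-inverseˡ : ∀ q → q ≢ 0ℚ → inv q ℚ.* q ≡ 1ℚ
inv-inverseˡ q@(mkℚ (+ zero) _ _) q≢0 = contradiction (ℚ.↥p≡0⇒p≡0 q refl) q≢0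
inv-inverseˡ q@(mkℚ ℤ.+[1+ _ ] _ _) _ = ℚ.*-inverseˡ q
inv-inverseˡ q@(mkℚ -[1+ _ ] _ _) _ = ℚ.*-inverseˡ q

^ℤ-clear : ∀ {a} → a ≢ 0ℤ → ∀ k → (toℚ a ^ℤ k) ℚ.* toℚ (a ℤ.^ k ⁻) ≡ toℚ (a ℤ.^ k ⁺)
^ℤ-clear {a} a≢0 (+ n) = trans (ℚ.*-identityʳ (toℚ a ^ℕ n)) (sym (toℚ-^ a n))
^ℤ-clear {a} a≢0 -[1+ n ] = begin
  inv (toℚ a ^ℕ suc n) ℚ.* toℚ (a ℤ.^ suc n)
    ≡⟨ cong (λ q → inv q ℚ.* toℚ (a ℤ.^ suc n)) (toℚ-^ a (suc n)) ⟨
  inv (toℚ (a ℤ.^ suc n)) ℚ.* toℚ (a ℤ.^ suc n)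
    ≡⟨ inv-inverseˡ _ (^-≢0 a≢0 (suc n) ∘ toℚ-injective) ⟩
  1ℚ
    ∎
  where open ≡-Reasoning

∏-clear : ∀ {r} {g : Fin r → ℤ} → (∀ i → g i ≢ 0ℤ) → (k : Fin r → ℤ) →
  ∏ (λ i → toℚ (g i) ^ℤ k i) ℚ.* toℚ (∏ℤ (λ i → g i ℤ.^ k i ⁻)) ≡
  toℚ (∏ℤ (λ i → g i ℤ.^ k i ⁺))
∏-clear {zero} _ _ = refl
∏-clear {suc r} {g} g≢0 k = begin
  (q₀ ℚ.* Q) ℚ.* toℚ (d₀ *ℤ D)            ≡⟨ cong ((q₀ ℚ.* Q) ℚ.*_) (toℚ-* d₀ D) ⟩
  (q₀ ℚ.* Q) ℚ.* (toℚ d₀ ℚ.* toℚ D)       ≡⟨ ℚ-*-interchange q₀ Q (toℚ d₀) (toℚ D) ⟩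
  (q₀ ℚ.* toℚ d₀) ℚ.* (Q ℚ.* toℚ D)
    ≡⟨ cong₂ ℚ._*_ (^ℤ-clear (g≢0 zero) (k zero)) (∏-clear (g≢0 ∘ suc) (k ∘ suc)) ⟩
  toℚ n₀ ℚ.* toℚ N                        ≡⟨ toℚ-* n₀ N ⟨
  toℚ (n₀ *ℤ N)                           ∎
  where
  open ≡-Reasoning
  q₀ = toℚ (g zero) ^ℤ k zero
  Q = ∏ (λ i → toℚ (g (suc i)) ^ℤ k (suc i))
  d₀ = g zero ℤ.^ k zero ⁻
  D = ∏ℤ (λ i → g (suc i) ℤ.^ k (suc i) ⁻)
  n₀ = g zero ℤ.^ k zero ⁺
  N = ∏ℤ (λ i → g (suc i) ℤ.^ k (suc i) ⁺)

clear-denominators : ∀ {r} {g : Fin r → ℤ} → (∀ i → g i ≢ 0ℤ) → ∀ {a m} (k : Fin r → ℤ) →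
  toℚ a ^ℕ m ≡ ∏ (λ i → toℚ (g i) ^ℤ k i) →
  a ℤ.^ m *ℤ ∏ℤ (λ i → g i ℤ.^ k i ⁻) ≡ ∏ℤ (λ i → g i ℤ.^ k i ⁺)
clear-denominators {g = g} g≢0 {a} {m} k aᵐ≡∏ = toℚ-injective (begin
  toℚ (a ℤ.^ m *ℤ D)                                ≡⟨ toℚ-* (a ℤ.^ m) D ⟩
  toℚ (a ℤ.^ m) ℚ.* toℚ D                           ≡⟨ cong (ℚ._* toℚ D) (trans (toℚ-^ a m) aᵐ≡∏) ⟩
  ∏ (λ i → toℚ (g i) ^ℤ k i) ℚ.* toℚ D              ≡⟨ ∏-clear g≢0 k ⟩
  toℚ (∏ℤ (λ i → g i ℤ.^ k i ⁺))                    ∎)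
  where
  open ≡-Reasoning
  D = ∏ℤ (λ i → g i ℤ.^ k i ⁻)

cleared⇒base≢0 : ∀ {r} {g : Fin r → ℤ} → (∀ i → g i ≢ 0ℤ) → ∀ {a m} (k : Fin r → ℤ) → 1 ≤ m →
  a ℤ.^ m *ℤ ∏ℤ (λ i → g i ℤ.^ k i ⁻) ≡ ∏ℤ (λ i → g i ℤ.^ k i ⁺) → a ≢ 0ℤ
cleared⇒base≢0 {g = g} g≢0 {m = suc m} k _ cleared refl =
  ∏ℤ-≢0 (λ i → ^-≢0 (g≢0 i) (k i ⁺)) (trans (sym cleared) (begin
    0ℤ ℤ.^ suc m *ℤ D     ≡⟨ cong (_*ℤ D) (ℤ.*-zeroˡ (0ℤ ℤ.^ m)) ⟩
    0ℤ *ℤ D               ≡⟨ ℤ.*-zeroˡ D ⟩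
    0ℤ                    ∎))
  where
  open ≡-Reasoning
  D = ∏ℤ (λ i → g i ℤ.^ k i ⁻)

+-∑ℕ : ∀ {r} (f : Fin r → ℕ) → + ∑ℕ f ≡ ∑[ i < r ] (+ f i)
+-∑ℕ {zero} f = refl
+-∑ℕ {suc r} f = trans (ℤ.pos-+ (f zero) (∑ℕ (f ∘ suc))) (cong (+ f zero +ℤ_) (+-∑ℕ (f ∘ suc)))

⁺-split : ∀ k w → + (k ⁺ * w) ≡ k *ℤ + w +ℤ + (k ⁻ * w)
⁺-split (+ n) w = trans (ℤ.pos-* n w) (sym (ℤ.+-identityʳ (+ n *ℤ + w)))
⁺-split -[1+ n ] w = begin
  0ℤ                                    ≡⟨ ℤ.+-inverseˡ (+ (suc n * w)) ⟨
  - + (suc n * w) +ℤ + (suc n * w)      ≡⟨ cong (λ x → - x +ℤ + (suc n * w)) (ℤ.pos-* (suc n) w) ⟩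
  - (+ suc n *ℤ + w) +ℤ + (suc n * w)   ≡⟨ cong (_+ℤ + (suc n * w)) (ℤ.neg-distribˡ-* (+ suc n) (+ w)) ⟩
  -[1+ n ] *ℤ + w +ℤ + (suc n * w)      ∎
  where open ≡-Reasoning

module _ {p : ℕ} (p-prime : Prime p) {r} {g : Fin r → ℤ} {w : Fin r → ℕ}
         (valuation-g : ∀ i → Valuation p ∣ g i ∣ (w i)) where

  valuation-cleared : ∀ {a m e} (k : Fin r → ℤ) →
    a ℤ.^ m *ℤ ∏ℤ (λ i → g i ℤ.^ k i ⁻) ≡ ∏ℤ (λ i → g i ℤ.^ k i ⁺) →
    Valuation p ∣ a ∣ e → + (m * e) ≡ ∑[ i < r ] (k i *ℤ + w i)
  valuation-cleared {a} {m} {e} k cleared valuation-a = +-cancelʳ (+ N) (+ (m * e)) S (begin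
    + (m * e) +ℤ + N                               ≡⟨ ℤ.pos-+ (m * e) N ⟨
    + (m * e ℕ.+ N)                                ≡⟨ cong +_ exponents ⟩
    + P                                            ≡⟨ +-∑ℕ (λ i → k i ⁺ * w i) ⟩
    ∑[ i < r ] (+ (k i ⁺ * w i))                   ≡⟨ ∑-cong (λ i → ⁺-split (k i) (w i)) ⟩
    ∑[ i < r ] (k i *ℤ + w i +ℤ + (k i ⁻ * w i))
      ≡⟨ ∑-distrib-+ (λ i → k i *ℤ + w i) (λ i → + (k i ⁻ * w i)) ⟩
    S +ℤ ∑[ i < r ] (+ (k i ⁻ * w i))              ≡⟨ cong (S +ℤ_) (+-∑ℕ (λ i → k i ⁻ * w i)) ⟨
    S +ℤ + N                                       ∎)
    where
    open ≡-Reasoning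
    S = ∑[ i < r ] (k i *ℤ + w i)
    N = ∑ℕ (λ i → k i ⁻ * w i)
    P = ∑ℕ (λ i → k i ⁺ * w i)
    exponents : m * e ℕ.+ N ≡ P
    exponents = valuation-unique p-prime
      (subst (λ x → Valuation p ∣ x ∣ (m * e ℕ.+ N)) cleared
        (valuation-∣*∣ p-prime {a ℤ.^ m} (valuation-∣^∣ p-prime valuation-a m)
          (valuation-∣∏∣ p-prime (λ i → valuation-∣^∣ p-prime (valuation-g i) (k i ⁻)))))
      (valuation-∣∏∣ p-prime (λ i → valuation-∣^∣ p-prime (valuation-g i) (k i ⁺)))

module _ (z : ℕ → ℤ) {r : ℕ} {g : Fin r → ℤ} (g≢0 : ∀ i → g i ≢ 0ℤ)
         {n : ℕ} (idx : Fin n → ℕ) (idx-injective : Injective _≡_ _≡_ idx) (idx≥1 : ∀ j → 1 ≤ idx j)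
         (Γbar : ∀ j → InΓbar g (z (idx j))) (has-primitive : ∀ j → ∃ (PrimitivePrimeDivisor z (idx j))) where

  private
    m : Fin n → ℕ
    m j = proj₁ (Γbar j)

    k : Fin n → Fin r → ℤ
    k j = proj₁ (proj₂ (proj₂ (Γbar j)))

    cleared : ∀ j → z (idx j) ℤ.^ m j *ℤ ∏ℤ (λ i → g i ℤ.^ k j i ⁻) ≡ ∏ℤ (λ i → g i ℤ.^ k j i ⁺)
    cleared j = clear-denominators g≢0 {z (idx j)} {m j} (k j) (proj₂ (proj₂ (proj₂ (Γbar j))))

    ∣z∣≢0 : ∀ j → ∣ z (idx j) ∣ ≢ 0
    ∣z∣≢0 j = cleared⇒base≢0 g≢0 (k j) (proj₁ (proj₂ (Γbar j))) (cleared j) ∘ ℤ.∣i∣≡0⇒i≡0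

    module AtPrime {p : ℕ} (p-prime : Prime p) where

      w : Fin r → ℕ
      w i = proj₁ (valuation-exists p-prime (g≢0 i ∘ ℤ.∣i∣≡0⇒i≡0))

      valuation-g : ∀ i → Valuation p ∣ g i ∣ (w i)
      valuation-g i = proj₂ (valuation-exists p-prime (g≢0 i ∘ ℤ.∣i∣≡0⇒i≡0))

      e : Fin n → ℕ
      e j = proj₁ (valuation-exists p-prime (∣z∣≢0 j))

      valuation-z : ∀ j → Valuation p ∣ z (idx j) ∣ (e j)
      valuation-z j = proj₂ (valuation-exists p-prime (∣z∣≢0 j))

      ∑-weighted≡0 : ∀ c → IsRelation k c → ∑[ j < n ] (c j *ℤ + (m j * e j)) ≡ 0ℤ
      ∑-weighted≡0 c rel = trans
        (∑-cong λ j → cong (c j *ℤ_)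
          (valuation-cleared p-prime valuation-g {z (idx j)} {m j} (k j) (cleared j) (valuation-z j)))
        (isRelation⇒∑-weighted≡0 {v = k} {c} rel (λ i → + w i))

    no-top-relation : ∀ c → IsRelation k c → (t : Fin n) → c t ≢ 0ℤ →
      (∀ j → c j ≢ 0ℤ → idx j ℕ.≤ idx t) → ⊥
    no-top-relation c rel t ct≢0 top with has-primitive t
    ... | p , p-prime , p∣zₜ , p∤earlier = top-term≢0 (begin
      c t *ℤ + (m t * e t)                 ≡⟨ ∑-concentrated t vanish ⟨
      ∑[ j < n ] (c j *ℤ + (m j * e j))    ≡⟨ ∑-weighted≡0 c rel ⟩
      0ℤ                                   ∎)
      where
      open ≡-Reasoning
      open AtPrime p-prime

      vanish : ∀ j → j ≢ t → c j *ℤ + (m j * e j) ≡ 0ℤ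
      vanish j j≢t with c j ≟ 0ℤ
      ... | yes cj≡0 = trans (cong (_*ℤ + (m j * e j)) cj≡0) (ℤ.*-zeroˡ (+ (m j * e j)))
      ... | no cj≢0 = begin
        c j *ℤ + (m j * e j)   ≡⟨ cong (λ x → c j *ℤ + (m j * x)) eⱼ≡0 ⟩
        c j *ℤ + (m j * 0)     ≡⟨ cong (λ x → c j *ℤ + x) (ℕ.*-zeroʳ (m j)) ⟩
        c j *ℤ 0ℤ              ≡⟨ ℤ.*-zeroʳ (c j) ⟩
        0ℤ                     ∎
        where
        idxⱼ<idxₜ : idx j < idx t
        idxⱼ<idxₜ = ℕ.≤∧≢⇒< (top j cj≢0) (j≢t ∘ idx-injective)
        eⱼ≡0 : e j ≡ 0
        eⱼ≡0 = valuation-unique p-prime (valuation-z j)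
          (valuation-non-multiple p-prime (p∤earlier (idx j) (idx≥1 j) idxⱼ<idxₜ))

      top-term≢0 : c t *ℤ + (m t * e t) ≢ 0ℤ
      top-term≢0 eq with ℤ.i*j≡0⇒i≡0∨j≡0 (c t) eq
      ... | inj₁ ct≡0 = ct≢0 ct≡0
      ... | inj₂ mₜeₜ≡0 with ℕ.m*n≡0⇒m≡0∨n≡0 (m t) (ℤ.+-injective mₜeₜ≡0)
      ...   | inj₁ mₜ≡0 = ℕ.<⇒≢ (proj₁ (proj₂ (Γbar t))) (sym mₜ≡0)
      ...   | inj₂ eₜ≡0 = valuation-multiple p-prime p∣zₜ (valuation-z t) eₜ≡0

  primitive-in-Γbar-≤ : n ℕ.≤ r
  primitive-in-Γbar-≤ = ℕ.≮⇒≥ λ r<n →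
    let c , nontrivial , rel = d<n⇒nontrivialRelation r<n k
        t , ct≢0 , top = argmax (λ j → ¬? (c j ≟ 0ℤ)) idx nontrivial
    in no-top-relation c rel t ct≢0 top

module _ {A : Set} where

  length-filter-∁ : ∀ {p} {P : Pred A p} (P? : Decidable P) (xs : List A) →
    length xs ≡ length (filter P? xs) ℕ.+ length (filter (∁? P?) xs)
  length-filter-∁ P? [] = refl
  length-filter-∁ P? (x ∷ xs) with P? x
  ... | yes _ = cong suc (length-filter-∁ P? xs)
  ... | no _ = trans (cong suc (length-filter-∁ P? xs)) (sym (ℕ.+-suc _ _))

  All-lookup : ∀ {p} {P : Pred A p} {xs : List A} → All P xs → ∀ i → P (lookup xs i)
  All-lookup all i = All.lookup all (∈-lookup i)

  lookup-injective : ∀ {xs : List A} → Unique xs → Injective _≡_ _≡_ (lookup xs)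
  lookup-injective {x ∷ xs} _ {zero} {zero} _ = refl
  lookup-injective {x ∷ xs} (x≢xs ∷ _) {zero} {suc j} x≡xsⱼ = contradiction x≡xsⱼ (All-lookup x≢xs j)
  lookup-injective {x ∷ xs} (x≢xs ∷ _) {suc i} {zero} xsᵢ≡x = contradiction (sym xsᵢ≡x) (All-lookup x≢xs i)
  lookup-injective {x ∷ xs} (_ ∷ unique) {suc i} {suc j} xsᵢ≡xsⱼ = cong suc (lookup-injective unique xsᵢ≡xsⱼ)

unique-<-≤ : ∀ {N} {ns : List ℕ} → Unique ns → All (_< N) ns → length ns ℕ.≤ N
unique-<-≤ {N} {ns} unique all< = Fin.injective⇒≤ {f = λ j → Fin.fromℕ< (All-lookup all< j)}
  (λ {i} {j} eq → lookup-injective unique (Fin.fromℕ<-injective _ _ (All-lookup all< i) (All-lookup all< j) eq))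

lemma6p1 : (z : ℕ → ℤ) → EventuallyZsigmondy z → (r : ℕ) → 1 ≤ r →
    Σ ℕ λ C → (g : Fin r → ℤ) → (∀ i → g i ≢ + 0) → MinimalGenerators g →
      (ns : List ℕ) → Unique ns → All (λ n → 1 ≤ n × InΓbar g (z n)) ns →
      length ns ≤ C
lemma6p1 z (N₀ , _ , zsigmondy) r _ = N₀ ℕ.+ r , λ g g≢0 _ ns unique members →
  let large = filter (∁? (_<? N₀)) ns
      large-members = All.filter⁺ (∁? (_<? N₀)) members
      small≤N₀ = unique-<-≤ (Unique.filter⁺ (_<? N₀) unique) (All.all-filter (_<? N₀) ns)
      large≤r = primitive-in-Γbar-≤ z g≢0 (lookup large) (lookup-injective (Unique.filter⁺ (∁? (_<? N₀)) unique))
        (proj₁ ∘ All-lookup large-members) (proj₂ ∘ All-lookup large-members)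
        (λ j → zsigmondy (lookup large j) (ℕ.≮⇒≥ (All-lookup (All.all-filter (∁? (_<? N₀)) ns) j)))
  in begin
    length ns                                         ≡⟨ length-filter-∁ (_<? N₀) ns ⟩
    length (filter (_<? N₀) ns) ℕ.+ length large      ≤⟨ ℕ.+-mono-≤ small≤N₀ large≤r ⟩
    N₀ ℕ.+ r                                          ∎
  where open ℕ.≤-Reasoning
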